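{- Fix $\epsilon<1/40$. Let $G$ be a graph, $P=K_3\times G$, $H$ be $\epsilon$-near $P$ via bijection $\psi$, $C$ the candidate edge graph and $\mathcal T(C)$ the triangle graph. Let $Y_j$ be a core component of $\mathcal T(C)$ and $T\in Y_j$. Then for every $u\in T$, with $g=\psi_G(u)$, the core triangle $\psi^{ -1}(\{a,b,c\}\times\{g\})$ belongs to $Y_j$.
   Context: Graphs are finite, undirected, simple, loopless. $\Gamma_X(v)$ is the neighbourhood of $v$ in $X$, $I_X(u,v)=\Gamma_X(u)\cap\Gamma_X(v)$. The tensor product $F\times G$ has vertex set $V(F)\times V(G)$, with $(f,g)$, $(f',g')$ adjacent iff $\{f,f'\}\in E(F)$ and $\{g,g'\}\in E(G)$. $K_3$ is the complete graph on $\{a,b,c\}$. $H$ is $\epsilon$-near $P=K_3\times G$ means: there is $E'\subseteq E(P)$ such that each vertex $w$ of $P$ has at most $\epsilon|\Gamma_P(w)|$ incident edges in $E'$, and a bijection $\psi:V(H)\to V(P)$, $\psi(v)=(\psi_{K_3}(v),\psi_G(v))$, which is a graph isomorphism from $H$ onto $(V(P),E(P)\setminus E')$. A core triangle is a set $\psi^{ -1}(\{a,b,c\}\times\{g\})$, $g\in V(G)$. The candidate edge graph $C$ has vertex set $V(H)$; distinct $u,v$ with $|\Gamma_H(u)|\ge|\Gamma_H(v)|$ are adjacent in $C$ iff (i) $|\Gamma_H(u)|-|\Gamma_H(v)|\le 2\epsilon|\Gamma_H(u)|$ and (ii) $(1-6\epsilon)\frac{|\Gamma_H(u)|}{2}\le|I_H(u,v)|\le\frac{1}{1-\epsilon}\cdot\frac{|\Gamma_H(u)|}{2}$.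 $\mathcal T(C)$ has as vertices the triangles of $C$ (3-sets pairwise adjacent in $C$); $T_1,T_2$ are adjacent (compatible) iff disjoint and there are indexings $T_1=\{u_1,u_2,u_3\}$, $T_2=\{v_1,v_2,v_3\}$ with $\{u_i,v_j\}\in E(H)$ iff $i\ne j$. Vertices $g,g'$ of $G$ are $\epsilon$-confusable if $|I_G(g,g')|>(1-9\epsilon)\max\{|\Gamma_G(g)|,|\Gamma_G(g')|\}$. A 3-set of vertices of $H$ is quasi-core if its three color classes $\psi_{K_3}$ are pairwise distinct and its $G$-classes $\psi_G$ are pairwise $\epsilon$-confusable. A core component of $\mathcal T(C)$ is a connected component all of whose triangles are quasi-core. -}

module Defs where

open import Data.Bool using (Bool; true; false; _∧_; not; if_then_else_)
open import Data.Nat using (ℕ; _≤_; _⊔_)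
open import Data.Fin using (Fin; _≟_)
open import Data.Fin.Permutation using (Permutation′; _⟨$⟩ʳ_)
open import Data.List using (List; map; allFin)
open import Data.Nat.ListAction using (sum)
open import Data.Product using (Σ; ∃; _×_; _,_; proj₁; proj₂)
open import Data.Sum using (_⊎_)
open import Data.Integer using (+_)
open import Data.Rational using (ℚ; _/_; _*_; _-_; _<_; ½; 1ℚ)
import Data.Rational as ℚ
open import Relation.Nullary using (¬_)
open import Relation.Nullary.Decidable using (⌊_⌋)
open import Relation.Binary.PropositionalEquality using (_≡_; _≢_)
open import Relation.Binary.Construct.Closure.ReflexiveTransitive using (Star)
open import Function.Bundles using (_⤖_; _⇔_; Bijection)

ℕ→ℚ : ℕ → ℚ
ℕ→ℚ n = + n / 1

count : ∀ {n} → (Fin n → Bool) → ℕ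
count {n} f = sum (map (λ i → if f i then 1 else 0) (allFin n))

record Graph (n : ℕ) : Set where
  field
    adj    : Fin n → Fin n → Bool
    sym    : ∀ u v → adj u v ≡ adj v u
    irrefl : ∀ v → adj v v ≡ false
open Graph public

deg : ∀ {n} → Graph n → Fin n → ℕ
deg X v = count (adj X v)

common : ∀ {n} → Graph n → Fin n → Fin n → ℕ
common X u v = count (λ w → adj X u w ∧ adj X v w)

-- P = K₃ × G, vertex set Fin 3 × Fin m  (a = 0, b = 1, c = 2)

PV : ℕ → Set
PV m = Fin 3 × Fin m

adjP : ∀ {m} → Graph m → PV m → PV m → Bool
adjP G (k , g) (k' , g') = not ⌊ k ≟ k' ⌋ ∧ adj G g g'

countP : ∀ {m} → (PV m → Bool) → ℕ
countP f = sum (map (λ k → count (λ g → f (k , g))) (allFin 3))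

degP : ∀ {m} → Graph m → PV m → ℕ
degP G w = countP (adjP G w)

-- H is ε-near P = K₃ × G via the bijection ψ : V(H) → V(P):
-- there is a set E' ⊆ E(P) of edges (given as a symmetric boolean
-- relation), each vertex w of P meeting at most ε|Γ_P(w)| edges of E',
-- and ψ is an isomorphism from H onto (V(P), E(P) \ E').
record Near {N m : ℕ} (ε : ℚ) (G : Graph m) (H : Graph N)
            (ψ : Fin N ⤖ PV m) : Set where
  field
    removed     : PV m → PV m → Bool
    removed-sym : ∀ x y → removed x y ≡ removed y x
    removed-⊆   : ∀ x y → removed x y ≡ true → adjP G x y ≡ true
    removed-few : ∀ w → ℚ._≤_ (ℕ→ℚ (countP (removed w))) (ε * ℕ→ℚ (degP G w))
    iso         : ∀ u v → adj H u v ≡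
                    (adjP G (Bijection.to ψ u) (Bijection.to ψ v)
                      ∧ not (removed (Bijection.to ψ u) (Bijection.to ψ v)))

-- condition (i) and (ii) for the ordered pair (u,v) with |Γ(u)| ≥ |Γ(v)|.
-- The upper bound |I| ≤ (1/(1-ε))·|Γ(u)|/2 is stated with the positive
-- factor (1-ε) cleared:  (1-ε)·|I| ≤ |Γ(u)|/2.
candCond : ∀ {N} → ℚ → Graph N → Fin N → Fin N → Set
candCond ε H u v =
  ℚ._≤_ (ℕ→ℚ (deg H u) - ℕ→ℚ (deg H v)) ((ℕ→ℚ 2 * ε) * ℕ→ℚ (deg H u))
  × ℚ._≤_ ((1ℚ - ℕ→ℚ 6 * ε) * (ℕ→ℚ (deg H u) * ½)) (ℕ→ℚ (common H u v))
  × ℚ._≤_ ((1ℚ - ε) * ℕ→ℚ (common H u v)) (ℕ→ℚ (deg H u) * ½)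

CandAdj : ∀ {N} → ℚ → Graph N → Fin N → Fin N → Set
CandAdj ε H u v =
  u ≢ v × ((deg H v ≤ deg H u × candCond ε H u v)
          ⊎ (deg H u ≤ deg H v × candCond ε H v u))

record Triangle {N : ℕ} (ε : ℚ) (H : Graph N) : Set where
  field
    pt   : Fin 3 → Fin N
    cadj : ∀ i j → i ≢ j → CandAdj ε H (pt i) (pt j)
open Triangle public

_∈T_ : ∀ {N ε} {H : Graph N} → Fin N → Triangle ε H → Set
u ∈T T = ∃ λ i → pt T i ≡ u

Compatible : ∀ {N ε} {H : Graph N} → Triangle ε H → Triangle ε H → Set
Compatible {H = H} T₁ T₂ =
  (∀ u → u ∈T T₁ → ¬ (u ∈T T₂))
  × Σ (Permutation′ 3) λ σ → Σ (Permutation′ 3) λ τ →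
      ∀ i j → (adj H (pt T₁ (σ ⟨$⟩ʳ i)) (pt T₂ (τ ⟨$⟩ʳ j)) ≡ true) ⇔ (i ≢ j)

Reach : ∀ {N ε} {H : Graph N} → Triangle ε H → Triangle ε H → Set
Reach = Star Compatible

Confusable : ∀ {m} → ℚ → Graph m → Fin m → Fin m → Set
Confusable ε G g g' =
  (1ℚ - ℕ→ℚ 9 * ε) * ℕ→ℚ (deg G g ⊔ deg G g') < ℕ→ℚ (common G g g')

QuasiCore : ∀ {N m ε} {H : Graph N} → Graph m → Fin N ⤖ PV m →
            Triangle ε H → Set
QuasiCore {ε = ε} G ψ T =
  ∀ i j → i ≢ j →
    proj₁ (Bijection.to ψ (pt T i)) ≢ proj₁ (Bijection.to ψ (pt T j))
    × Confusable ε G (proj₂ (Bijection.to ψ (pt T i)))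
                     (proj₂ (Bijection.to ψ (pt T j)))

IsCoreTriangleOf : ∀ {N m ε} {H : Graph N} → Fin N ⤖ PV m → Fin m →
                   Triangle ε H → Set
IsCoreTriangleOf ψ g T =
  ∀ w → (w ∈T T) ⇔ (proj₂ (Bijection.to ψ w) ≡ g)

{-# OPTIONS --safe #-}
module Submission where

-- The colours of a quasi-core triangle T are distinct and its G-classes g₀, g₁, g₂ are pairwise
-- ε-confusable, so by inclusion–exclusion g₀, g₁, g₂ have more than (1 − 18ε)M common neighbours
-- in G, M being the largest of their degrees. The three vertices of T and the three vertices of
-- the core triangle over g = ψ_G(u) each lost at most 2εM edges, so when 30ε ≤ 1 some common
-- neighbour h keeps all edges between these six vertices and the column {a,b,c} × {h}. The core
-- triangle over h is then compatible with T and with the core triangle over g. Core triangles are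
-- triangles of C: two vertices (k,h), (k′,h) of P have 2·deg h neighbours each and share the deg h
-- neighbours of the third colour, and removing an ε-fraction of edges barely changes these counts.

open import Defs hiding (sym)
open import Data.Bool.Base using (Bool; true; false; _∧_; _∨_; not; if_then_else_)
open import Data.Nat.Base as ℕ using (ℕ; zero; suc)
import Data.Nat.Properties as ℕ
open import Data.Fin.Base using (Fin; zero; suc)
open import Data.Product using (Σ; ∃; _×_; _,_; proj₁; proj₂)
open import Function.Base using (_∘_)
open import Function.Bundles using (_⤖_; Bijection)
open import Relation.Binary.PropositionalEquality
open import Algebra.Properties.CommutativeMonoid.Sum ℕ.+-0-commutativeMonoid
  using (sum-syntax; sum-cong-≗; ∑-distrib-+; ∑-permute)

module RationalArithmetic where
  open import Data.Integer.Base as ℤ using (+_)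
  import Data.Integer.Properties as ℤ
  open import Data.Rational.Base
    using (ℚ; mkℚ; _+_; _-_; _*_; -_; _≤_; _<_; 0ℚ; 1ℚ; ½; _/_; *≤*; *<*; nonNegative)
  open import Data.Rational.Properties
    using ( _≟_; +-*-commutativeRing; normalize-coprime; toℚᵘ-injective; toℚᵘ-homo-+
          ; ≤-reflexive; ≤-trans; <⇒≤; ≤ᵇ⇒≤; module ≤-Reasoning
          ; +-identityˡ; +-inverseʳ; *-zeroˡ; +-mono-≤; +-mono-<-≤; +-monoˡ-≤; +-monoˡ-<
          ; *-monoˡ-≤-nonNeg; *-monoʳ-≤-nonNeg; nonNegative⁻¹; nonNeg*nonNeg⇒nonNeg)
  open import Data.Nat.Coprimality as Coprimality using (Coprime; 1-coprimeTo)
  import Data.Rational.Unnormalised.Base as ℚᵘ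
  import Data.Rational.Unnormalised.Properties as ℚᵘ
  open import Relation.Nullary.Decidable using (dec⇒maybe)
  open import Data.Unit.Base using (tt)
  open import Level using (0ℓ)
  open import Tactic.RingSolver using (solve-∀)
  import Tactic.RingSolver.Core.AlmostCommutativeRing as ACR

  private
    ring : ACR.AlmostCommutativeRing 0ℓ 0ℓ
    ring = ACR.fromCommutativeRing +-*-commutativeRing (λ x → dec⇒maybe (0ℚ ≟ x))

    n/1-coprime : ∀ n → Coprime n 1
    n/1-coprime n = Coprimality.sym (1-coprimeTo n)

  ℕ→ℚ≡mkℚ : ∀ n → ℕ→ℚ n ≡ mkℚ (+ n) 0 (n/1-coprime n)
  ℕ→ℚ≡mkℚ n = normalize-coprime (n/1-coprime n)

  ℕ→ℚ-+ : ∀ m n → ℕ→ℚ (m ℕ.+ n) ≡ ℕ→ℚ m + ℕ→ℚ n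
  ℕ→ℚ-+ m n rewrite ℕ→ℚ≡mkℚ (m ℕ.+ n) | ℕ→ℚ≡mkℚ m | ℕ→ℚ≡mkℚ n =
    toℚᵘ-injective (ℚᵘ.≃-trans (ℚᵘ.*≡* cross-multiplied)
      (ℚᵘ.≃-sym (toℚᵘ-homo-+ (mkℚ (+ m) 0 (n/1-coprime m)) (mkℚ (+ n) 0 (n/1-coprime n)))))
    where
    cross-multiplied : + (m ℕ.+ n) ℤ.* + 1 ≡ (+ m ℤ.* + 1 ℤ.+ + n ℤ.* + 1) ℤ.* + 1
    cross-multiplied rewrite ℤ.*-identityʳ (+ m) | ℤ.*-identityʳ (+ n) = refl

  ℕ→ℚ-mono-≤ : ∀ {m n} → m ℕ.≤ n → ℕ→ℚ m ≤ ℕ→ℚ n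
  ℕ→ℚ-mono-≤ {m} {n} m≤n rewrite ℕ→ℚ≡mkℚ m | ℕ→ℚ≡mkℚ n =
    *≤* (subst₂ ℤ._≤_ (sym (ℤ.*-identityʳ (+ m))) (sym (ℤ.*-identityʳ (+ n))) (ℤ.+≤+ m≤n))

  ℕ→ℚ-cancel-< : ∀ {m n} → ℕ→ℚ m < ℕ→ℚ n → m ℕ.< n
  ℕ→ℚ-cancel-< {m} {n} m<n rewrite ℕ→ℚ≡mkℚ m | ℕ→ℚ≡mkℚ n with m<n
  ... | *<* m*1<n*1 rewrite ℤ.*-identityʳ (+ m) | ℤ.*-identityʳ (+ n) = ℤ.drop‿+<+ m*1<n*1

  ℕ→ℚ-mono-≤-+ : ∀ a b c d → a ℕ.+ b ℕ.≤ c ℕ.+ d → ℕ→ℚ a + ℕ→ℚ b ≤ ℕ→ℚ c + ℕ→ℚ d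
  ℕ→ℚ-mono-≤-+ a b c d a+b≤c+d =
    subst₂ _≤_ (ℕ→ℚ-+ a b) (ℕ→ℚ-+ c d) (ℕ→ℚ-mono-≤ a+b≤c+d)

  0≤ℕ→ℚ : ∀ n → 0ℚ ≤ ℕ→ℚ n
  0≤ℕ→ℚ n = ℕ→ℚ-mono-≤ {0} {n} ℕ.z≤n

  ℕ→ℚ-∑-≤ : ∀ n (f : Fin n → ℕ) {B} → (∀ j → ℕ→ℚ (f j) ≤ B) → ℕ→ℚ (∑[ j < n ] f j) ≤ ℕ→ℚ n * B
  ℕ→ℚ-∑-≤ zero f {B} _ = ≤-reflexive (sym (*-zeroˡ B))
  ℕ→ℚ-∑-≤ (suc n) f {B} f≤B = begin
    ℕ→ℚ (f zero ℕ.+ ∑[ j < n ] f (suc j))         ≡⟨ ℕ→ℚ-+ (f zero) (∑[ j < n ] f (suc j)) ⟩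
    ℕ→ℚ (f zero) + ℕ→ℚ (∑[ j < n ] f (suc j))     ≤⟨ +-mono-≤ (f≤B zero) (ℕ→ℚ-∑-≤ n (f ∘ suc) (f≤B ∘ suc)) ⟩
    B + ℕ→ℚ n * B                                  ≡⟨ B+nB≡[1+n]B B (ℕ→ℚ n) ⟩
    (1ℚ + ℕ→ℚ n) * B                               ≡⟨ cong (_* B) (ℕ→ℚ-+ 1 n) ⟨
    ℕ→ℚ (suc n) * B                                ∎
    where
    open ≤-Reasoning
    B+nB≡[1+n]B : ∀ b n → b + n * b ≡ (1ℚ + n) * b
    B+nB≡[1+n]B = solve-∀ ring

  a+b≡c⇒a≡c-b : ∀ {a b c} → a + b ≡ c → a ≡ c - b
  a+b≡c⇒a≡c-b {a} {b} refl = a≡a+b-b a b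
    where
    a≡a+b-b : ∀ a b → a ≡ a + b - b
    a≡a+b-b = solve-∀ ring

  p≤q⇒0≤q-p : ∀ {p q} → p ≤ q → 0ℚ ≤ q - p
  p≤q⇒0≤q-p {p} {q} p≤q = subst (_≤ q - p) (+-inverseʳ p) (+-monoˡ-≤ (- p) p≤q)

  p<q⇒0<q-p : ∀ {p q} → p < q → 0ℚ < q - p
  p<q⇒0<q-p {p} {q} p<q = subst (_< q - p) (+-inverseʳ p) (+-monoˡ-< (- p) p<q)

  -- p ≤ q is certified by a ring identity q - p ≡ r exhibiting r as a sum of products of terms
  -- already known to be non-negative.
  ≤-by-certificate : ∀ {p q r} → q - p ≡ r → 0ℚ ≤ r → p ≤ q
  ≤-by-certificate {p} {q} refl 0≤q-p = subst₂ _≤_ (+-identityˡ p) (q-p+p≡q p q) (+-monoˡ-≤ p 0≤q-p)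
    where
    q-p+p≡q : ∀ p q → q - p + p ≡ q
    q-p+p≡q = solve-∀ ring

  <-by-certificate : ∀ {p q r} → q - p ≡ r → 0ℚ < r → p < q
  <-by-certificate {p} {q} refl 0<q-p = subst₂ _<_ (+-identityˡ p) (q-p+p≡q p q) (+-monoˡ-< p 0<q-p)
    where
    q-p+p≡q : ∀ p q → q - p + p ≡ q
    q-p+p≡q = solve-∀ ring

  private
    0≤+ : ∀ {p q} → 0ℚ ≤ p → 0ℚ ≤ q → 0ℚ ≤ p + q
    0≤+ = +-mono-≤

    0<+ : ∀ {p q} → 0ℚ < p → 0ℚ ≤ q → 0ℚ < p + q
    0<+ = +-mono-<-≤

    0≤* : ∀ {p q} → 0ℚ ≤ p → 0ℚ ≤ q → 0ℚ ≤ p * q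
    0≤* {p} {q} 0≤p 0≤q =
      nonNegative⁻¹ (p * q) {{nonNeg*nonNeg⇒nonNeg p {{nonNegative 0≤p}} q {{nonNegative 0≤q}}}}

  jε≤kε : ∀ {j k ε} → j ℕ.≤ k → 0ℚ ≤ ε → ℕ→ℚ j * ε ≤ ℕ→ℚ k * ε
  jε≤kε {ε = ε} j≤k 0≤ε = *-monoʳ-≤-nonNeg ε {{nonNegative 0≤ε}} (ℕ→ℚ-mono-≤ j≤k)

  0≤1-jε : ∀ {j k ε} → j ℕ.≤ k → 0ℚ ≤ ε → ℕ→ℚ k * ε ≤ 1ℚ → 0ℚ ≤ 1ℚ - ℕ→ℚ j * ε
  0≤1-jε j≤k 0≤ε kε≤1 = p≤q⇒0≤q-p (≤-trans (jε≤kε j≤k 0≤ε) kε≤1)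

  ε≤1/40⇒30ε≤1 : ∀ {ε} → ε ≤ + 1 / 40 → ℕ→ℚ 30 * ε ≤ 1ℚ
  ε≤1/40⇒30ε≤1 ε≤1/40 = ≤-trans (*-monoˡ-≤-nonNeg (ℕ→ℚ 30) ε≤1/40) (≤ᵇ⇒≤ tt)

  -- For two vertices of a core triangle over h: d = deg_G h, ru and rv count the removed edges
  -- at them, X and Y are their degrees in H and c their common degree in H.
  core-candidate-arithmetic : ∀ {ε d c ru rv} X Y → 0ℚ ≤ ε → ℕ→ℚ 6 * ε ≤ 1ℚ → 0ℚ ≤ d → 0ℚ ≤ ru →
    ru ≤ ε * (d + d) → rv ≤ ε * (d + d) → d ≤ c + ru + rv → c ≤ d →
    X ≡ (d + d) - ru → Y ≡ (d + d) - rv →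
    X - Y ≤ (ℕ→ℚ 2 * ε) * X × (1ℚ - ℕ→ℚ 6 * ε) * (X * ½) ≤ c × (1ℚ - ε) * c ≤ X * ½
  core-candidate-arithmetic {ε} {d} {c} {ru} {rv} _ _ 0≤ε 6ε≤1 0≤d 0≤ru ru≤ rv≤ d≤c+ru+rv c≤d refl refl =
    degree-gap , common-lower , common-upper
    where
    0≤1-jε′ : ∀ j → j ℕ.≤ 6 → 0ℚ ≤ 1ℚ - ℕ→ℚ j * ε
    0≤1-jε′ j j≤6 = 0≤1-jε j≤6 0≤ε 6ε≤1

    0≤ε[d+d] : 0ℚ ≤ ε * (d + d)
    0≤ε[d+d] = 0≤* 0≤ε (0≤+ 0≤d 0≤d)

    degree-gap : (d + d - ru) - (d + d - rv) ≤ (ℕ→ℚ 2 * ε) * (d + d - ru)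
    degree-gap = ≤-by-certificate (certificate ε d ru rv)
      (0≤+ (0≤+ (p≤q⇒0≤q-p rv≤) 0≤ε[d+d]) (0≤* (0≤1-jε′ 2 (ℕ.≤ᵇ⇒≤ 2 6 _)) 0≤ru))
      where
      certificate : ∀ ε d ru rv → (ℕ→ℚ 2 * ε) * (d + d - ru) - ((d + d - ru) - (d + d - rv))
                                ≡ ((ε * (d + d) - rv) + ε * (d + d)) + (1ℚ - ℕ→ℚ 2 * ε) * ru
      certificate = solve-∀ ring

    common-lower : (1ℚ - ℕ→ℚ 6 * ε) * ((d + d - ru) * ½) ≤ c
    common-lower = ≤-by-certificate (certificate ε d ru rv c)
      (0≤+ (0≤+ (0≤+ (0≤+ (p≤q⇒0≤q-p d≤c+ru+rv) (p≤q⇒0≤q-p ru≤)) (p≤q⇒0≤q-p rv≤)) 0≤ε[d+d])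
           (0≤* (0≤* (0≤1-jε′ 6 ℕ.≤-refl) (nonNegative⁻¹ ½)) 0≤ru))
      where
      certificate : ∀ ε d ru rv c → c - (1ℚ - ℕ→ℚ 6 * ε) * ((d + d - ru) * ½)
        ≡ ((((c + ru + rv) - d) + (ε * (d + d) - ru)) + (ε * (d + d) - rv)) + ε * (d + d)
          + ((1ℚ - ℕ→ℚ 6 * ε) * ½) * ru
      certificate = solve-∀ ring

    common-upper : (1ℚ - ε) * c ≤ (d + d - ru) * ½
    common-upper = ≤-by-certificate (certificate ε d ru c)
      (0≤+ (0≤* (0≤1-jε′ 1 (ℕ.≤ᵇ⇒≤ 1 6 _)) (p≤q⇒0≤q-p c≤d)) (0≤* (nonNegative⁻¹ ½) (p≤q⇒0≤q-p ru≤)))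
      where
      certificate : ∀ ε d ru c → (d + d - ru) * ½ - (1ℚ - ε) * c
                               ≡ (1ℚ - ℕ→ℚ 1 * ε) * (d - c) + ½ * (ε * (d + d) - ru)
      certificate = solve-∀ ring

  -- g₀ confusable with g₁ and g₂: c₁, c₂ are their common degrees, x, y the maxima of their degrees,
  -- M the largest of deg g₀, deg g₁, deg g₂, d₀ = deg g₀ and a the number of common neighbours of all
  -- three; r bounds the edges removed at six vertices of P whose G-coordinates are among g₀, g₁, g₂.
  common-neighbours-outnumber-removals : ∀ {ε a r c₁ c₂ x y M d₀} → 0ℚ ≤ ε → ℕ→ℚ 30 * ε ≤ 1ℚ →
    (1ℚ - ℕ→ℚ 9 * ε) * x < c₁ → (1ℚ - ℕ→ℚ 9 * ε) * y < c₂ → c₁ + c₂ ≤ a + d₀ →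
    M + d₀ ≤ x + y → 0ℚ ≤ d₀ → d₀ ≤ M → r ≤ ℕ→ℚ 6 * (ε * (M + M)) → r < a
  common-neighbours-outnumber-removals {ε} {a} {r} {c₁} {c₂} {x} {y} {M} {d₀}
    0≤ε 30ε≤1 x<c₁ y<c₂ c₁+c₂≤ M+d₀≤ 0≤d₀ d₀≤M r≤ =
    <-by-certificate (certificate ε a r c₁ c₂ x y M d₀)
      (0<+ (0<+ (0<+ (p<q⇒0<q-p x<c₁) (p≤q⇒0≤q-p c₁+c₂≤)) (<⇒≤ (p<q⇒0<q-p y<c₂)))
           (0≤+ (0≤+ (0≤+ (0≤* (0≤1-jε (ℕ.≤ᵇ⇒≤ 9 30 _) 0≤ε 30ε≤1) (p≤q⇒0≤q-p M+d₀≤))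
                          (0≤* (0≤* (0≤ℕ→ℚ 9) 0≤ε) (p≤q⇒0≤q-p d₀≤M)))
                     (0≤* (0≤1-jε {30} ℕ.≤-refl 0≤ε 30ε≤1) (≤-trans 0≤d₀ d₀≤M)))
                (p≤q⇒0≤q-p r≤)))
    where
    certificate : ∀ ε a r c₁ c₂ x y M d₀ → a - r ≡
      ((c₁ - (1ℚ - ℕ→ℚ 9 * ε) * x) + ((a + d₀) - (c₁ + c₂)) + (c₂ - (1ℚ - ℕ→ℚ 9 * ε) * y))
      + ((1ℚ - ℕ→ℚ 9 * ε) * ((x + y) - (M + d₀)) + (ℕ→ℚ 9 * ε) * (M - d₀)
         + (1ℚ - ℕ→ℚ 30 * ε) * M + (ℕ→ℚ 6 * (ε * (M + M)) - r))
    certificate = solve-∀ ring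

open RationalArithmetic

module Counting where
  open import Data.Nat.Base using (_+_; _≤_; _<_; z≤n; s≤s)
  open import Data.Fin.Base using (_↑ˡ_; _↑ʳ_; combine; remQuot)
  open import Data.Fin.Properties using (remQuot-combine; combine-remQuot; splitAt-↑ʳ)
  open import Data.Fin.Permutation using (Permutation; _⟨$⟩ʳ_)
  open import Data.Product using (uncurry; map; map₁; map₂)
  open import Data.List.Base using (allFin)
  import Data.Nat.ListAction as ListAction
  import Data.List.Properties as List
  open import Function.Bundles using (mk↔ₛ′)
  open import Function.Properties.Bijection using (⤖⇒↔)
  open import Function.Construct.Composition using (_↔-∘_)

  𝟙 : Bool → ℕ
  𝟙 b = if b then 1 else 0

  ∑-mono-≤ : ∀ {n} {f g : Fin n → ℕ} → (∀ i → f i ≤ g i) → ∑[ i < n ] f i ≤ ∑[ i < n ] g i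
  ∑-mono-≤ {zero} f≤g = z≤n
  ∑-mono-≤ {suc n} f≤g = ℕ.+-mono-≤ (f≤g zero) (∑-mono-≤ (f≤g ∘ suc))

  ∑-↑ : ∀ a {b} (f : Fin (a + b) → ℕ) → ∑[ i < a + b ] f i ≡ ∑[ i < a ] f (i ↑ˡ b) + ∑[ j < b ] f (a ↑ʳ j)
  ∑-↑ zero f = refl
  ∑-↑ (suc a) f = trans (cong (f zero +_) (∑-↑ a (f ∘ suc))) (sym (ℕ.+-assoc (f zero) _ _))

  ∑-remQuot : ∀ a {b} (F : Fin a × Fin b → ℕ) →
              ∑[ x < a ℕ.* b ] F (remQuot b x) ≡ ∑[ i < a ] ∑[ j < b ] F (i , j)
  ∑-remQuot zero F = refl
  ∑-remQuot (suc a) {b} F = begin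
    ∑[ x < b + a ℕ.* b ] F (remQuot b x)
      ≡⟨ ∑-↑ b (F ∘ remQuot b) ⟩
    ∑[ j < b ] F (remQuot b (j ↑ˡ a ℕ.* b)) + ∑[ x < a ℕ.* b ] F (remQuot b (b ↑ʳ x))
      ≡⟨ cong₂ _+_ (sum-cong-≗ (cong F ∘ remQuot-combine zero)) (sum-cong-≗ (cong F ∘ remQuot-↑ʳ)) ⟩
    ∑[ j < b ] F (zero , j) + ∑[ x < a ℕ.* b ] F (map₁ suc (remQuot b x))
      ≡⟨ cong (∑[ j < b ] F (zero , j) +_) (∑-remQuot a (F ∘ map₁ suc)) ⟩
    ∑[ i < suc a ] ∑[ j < b ] F (i , j) ∎
    where
    open ≡-Reasoning
    remQuot-↑ʳ : ∀ x → remQuot {suc a} b (b ↑ʳ x) ≡ map₁ suc (remQuot b x)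
    remQuot-↑ʳ x rewrite splitAt-↑ʳ b (a ℕ.* b) x = refl

  ∑-bijection : ∀ {N a b} (ψ : Fin N ⤖ (Fin a × Fin b)) (F : Fin a × Fin b → ℕ) →
                ∑[ w < N ] F (Bijection.to ψ w) ≡ ∑[ i < a ] ∑[ j < b ] F (i , j)
  ∑-bijection {N} {a} {b} ψ F = begin
    ∑[ w < N ] F (Bijection.to ψ w)
      ≡⟨ sum-cong-≗ (λ w → cong F (sym (uncurry remQuot-combine (Bijection.to ψ w)))) ⟩
    ∑[ w < N ] F (remQuot b (π ⟨$⟩ʳ w))
      ≡⟨ ∑-permute (F ∘ remQuot b) π ⟨
    ∑[ x < a ℕ.* b ] F (remQuot b x)
      ≡⟨ ∑-remQuot a F ⟩
    ∑[ i < a ] ∑[ j < b ] F (i , j) ∎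
    where
    open ≡-Reasoning
    π : Permutation N (a ℕ.* b)
    π = mk↔ₛ′ (uncurry combine) (remQuot b) (combine-remQuot {a} b) (λ (i , j) → remQuot-combine i j)
        ↔-∘ ⤖⇒↔ ψ

  count-suc : ∀ {n} (f : Fin (suc n) → Bool) → count f ≡ 𝟙 (f zero) + count (f ∘ suc)
  count-suc f = cong (𝟙 (f zero) +_) (cong ListAction.sum
    (trans (List.map-tabulate suc (𝟙 ∘ f)) (sym (List.map-tabulate (λ i → i) (𝟙 ∘ f ∘ suc)))))

  count≡∑ : ∀ {n} (f : Fin n → Bool) → count f ≡ ∑[ i < n ] 𝟙 (f i)
  count≡∑ {zero} f = refl
  count≡∑ {suc n} f = trans (count-suc f) (cong (𝟙 (f zero) +_) (count≡∑ (f ∘ suc)))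

  count-cong : ∀ {n} {f g : Fin n → Bool} → (∀ i → f i ≡ g i) → count f ≡ count g
  count-cong {n} f≗g = cong ListAction.sum (List.map-cong (cong 𝟙 ∘ f≗g) (allFin n))

  count-bijection : ∀ {N m} (ψ : Fin N ⤖ PV m) (f : PV m → Bool) → count (f ∘ Bijection.to ψ) ≡ countP f
  count-bijection {N} {m} ψ f = begin
    count (f ∘ Bijection.to ψ)                   ≡⟨ count≡∑ (f ∘ Bijection.to ψ) ⟩
    ∑[ w < N ] 𝟙 (f (Bijection.to ψ w))          ≡⟨ ∑-bijection ψ (𝟙 ∘ f) ⟩
    ∑[ k < 3 ] ∑[ g < m ] 𝟙 (f (k , g))          ≡⟨ sum-cong-≗ (λ k → count≡∑ (λ g → f (k , g))) ⟨
    countP f                                     ∎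
    where open ≡-Reasoning

  𝟙-mono : ∀ {a b} → (a ≡ true → b ≡ true) → 𝟙 a ≤ 𝟙 b
  𝟙-mono {false} _ = z≤n
  𝟙-mono {true} a⇒b rewrite a⇒b refl = ℕ.≤-refl

  𝟙-∧-not+𝟙 : ∀ a r → (r ≡ true → a ≡ true) → 𝟙 (a ∧ not r) + 𝟙 r ≡ 𝟙 a
  𝟙-∧-not+𝟙 true  true  _ = refl
  𝟙-∧-not+𝟙 true  false _ = refl
  𝟙-∧-not+𝟙 false true  r⇒a with () ← r⇒a refl
  𝟙-∧-not+𝟙 false false _ = refl

  𝟙≤𝟙-∧-not+𝟙 : ∀ a b → 𝟙 a ≤ 𝟙 (a ∧ not b) + 𝟙 b
  𝟙≤𝟙-∧-not+𝟙 true  true  = ℕ.≤-refl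
  𝟙≤𝟙-∧-not+𝟙 true  false = ℕ.≤-refl
  𝟙≤𝟙-∧-not+𝟙 false b     = z≤n

  𝟙-∨-≤ : ∀ a b → 𝟙 (a ∨ b) ≤ 𝟙 a + 𝟙 b
  𝟙-∨-≤ true  b = s≤s z≤n
  𝟙-∨-≤ false b = ℕ.≤-refl

  𝟙-inclusion-exclusion : ∀ x y z → 𝟙 (x ∧ y) + 𝟙 (x ∧ z) ≤ 𝟙 (x ∧ (y ∧ z)) + 𝟙 x
  𝟙-inclusion-exclusion true  true  true  = ℕ.≤-refl
  𝟙-inclusion-exclusion true  true  false = ℕ.≤-refl
  𝟙-inclusion-exclusion true  false true  = ℕ.≤-refl
  𝟙-inclusion-exclusion true  false false = z≤n
  𝟙-inclusion-exclusion false y     z     = z≤n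

  𝟙-∧-≤ : ∀ a b r s → 𝟙 (a ∧ b) ≤ 𝟙 ((a ∧ not r) ∧ (b ∧ not s)) + 𝟙 r + 𝟙 s
  𝟙-∧-≤ false b     r     s     = z≤n
  𝟙-∧-≤ true  false r     s     = z≤n
  𝟙-∧-≤ true  true  true  s     = s≤s z≤n
  𝟙-∧-≤ true  true  false true  = ℕ.≤-refl
  𝟙-∧-≤ true  true  false false = ℕ.≤-refl

  ∧-not-∧-not⇒∧ : ∀ a r b s → (a ∧ not r) ∧ (b ∧ not s) ≡ true → a ∧ b ≡ true
  ∧-not-∧-not⇒∧ true  false true  false _  = refl
  ∧-not-∧-not⇒∧ false r     b     s     ()
  ∧-not-∧-not⇒∧ true  true  b     s     ()
  ∧-not-∧-not⇒∧ true  false false s     ()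
  ∧-not-∧-not⇒∧ true  false true  true  ()

  ∧-≡-true : ∀ {a b} → a ∧ b ≡ true → a ≡ true × b ≡ true
  ∧-≡-true {true} {true} _ = refl , refl

  not-≡-true : ∀ {a} → not a ≡ true → a ≡ false
  not-≡-true {false} _ = refl

  module _ {n : ℕ} where

    count-+ : (f g : Fin n → Bool) → count f + count g ≡ ∑[ i < n ] (𝟙 (f i) + 𝟙 (g i))
    count-+ f g = trans (cong₂ _+_ (count≡∑ f) (count≡∑ g)) (sym (∑-distrib-+ (𝟙 ∘ f) (𝟙 ∘ g)))

    count-mono : {f g : Fin n → Bool} → (∀ i → f i ≡ true → g i ≡ true) → count f ≤ count g
    count-mono {f} {g} f⇒g =
      subst₂ _≤_ (sym (count≡∑ f)) (sym (count≡∑ g)) (∑-mono-≤ (λ i → 𝟙-mono (f⇒g i)))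

    count-+-mono : {f g f′ g′ : Fin n → Bool} → (∀ i → 𝟙 (f i) + 𝟙 (g i) ≤ 𝟙 (f′ i) + 𝟙 (g′ i)) →
                   count f + count g ≤ count f′ + count g′
    count-+-mono {f} {g} {f′} {g′} pointwise =
      subst₂ _≤_ (sym (count-+ f g)) (sym (count-+ f′ g′)) (∑-mono-≤ pointwise)

    count-≤-+ : {f g h : Fin n → Bool} → (∀ i → 𝟙 (f i) ≤ 𝟙 (g i) + 𝟙 (h i)) → count f ≤ count g + count h
    count-≤-+ {f} {g} {h} pointwise =
      subst₂ _≤_ (sym (count≡∑ f)) (sym (count-+ g h)) (∑-mono-≤ pointwise)

    count-∧-≤ : (a b r s : Fin n → Bool) → count (λ i → a i ∧ b i) ≤
                count (λ i → (a i ∧ not (r i)) ∧ (b i ∧ not (s i))) + count r + count s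
    count-∧-≤ a b r s = subst₂ _≤_ (sym (count≡∑ (λ i → a i ∧ b i))) three-sums
      (∑-mono-≤ (λ i → 𝟙-∧-≤ (a i) (b i) (r i) (s i)))
      where
      both : Fin n → Bool
      both i = (a i ∧ not (r i)) ∧ (b i ∧ not (s i))
      three-sums : ∑[ i < n ] (𝟙 (both i) + 𝟙 (r i) + 𝟙 (s i)) ≡ count both + count r + count s
      three-sums = trans (∑-distrib-+ (λ i → 𝟙 (both i) + 𝟙 (r i)) (𝟙 ∘ s))
                         (cong₂ _+_ (sym (count-+ both r)) (sym (count≡∑ s)))

    count-∧-not-≤ : (a b r s : Fin n → Bool) →
                    count (λ i → (a i ∧ not (r i)) ∧ (b i ∧ not (s i))) ≤ count (λ i → a i ∧ b i)
    count-∧-not-≤ a b r s = count-mono (λ i → ∧-not-∧-not⇒∧ (a i) (r i) (b i) (s i))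

    count-∧-not+count : (a r : Fin n → Bool) → (∀ i → r i ≡ true → a i ≡ true) →
                        count (λ i → a i ∧ not (r i)) + count r ≡ count a
    count-∧-not+count a r r⇒a = trans (count-+ (λ i → a i ∧ not (r i)) r)
      (trans (sum-cong-≗ (λ i → 𝟙-∧-not+𝟙 (a i) (r i) (r⇒a i))) (sym (count≡∑ a)))

    count≤count-∧-not+count : (a b : Fin n → Bool) → count a ≤ count (λ i → a i ∧ not (b i)) + count b
    count≤count-∧-not+count a b = count-≤-+ (λ i → 𝟙≤𝟙-∧-not+𝟙 (a i) (b i))

    count-∨-≤ : (a b : Fin n → Bool) → count (λ i → a i ∨ b i) ≤ count a + count b
    count-∨-≤ a b = count-≤-+ (λ i → 𝟙-∨-≤ (a i) (b i))

    count-inclusion-exclusion : (x y z : Fin n → Bool) →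
      count (λ i → x i ∧ y i) + count (λ i → x i ∧ z i) ≤ count (λ i → x i ∧ (y i ∧ z i)) + count x
    count-inclusion-exclusion x y z = count-+-mono (λ i → 𝟙-inclusion-exclusion (x i) (y i) (z i))

  count-false : ∀ n → count {n} (λ _ → false) ≡ 0
  count-false zero = refl
  count-false (suc n) = trans (count-suc {n} (λ _ → false)) (count-false n)

  count-∧ˡ : ∀ {n} b (f : Fin n → Bool) → count (λ i → b ∧ f i) ≡ (if b then count f else 0)
  count-∧ˡ true  f = refl
  count-∧ˡ {n} false f = count-false n

  count-pos : ∀ {n} (f : Fin n → Bool) → 0 < count f → ∃ λ i → f i ≡ true
  count-pos {suc n} f 0<count = by-cases (f zero) refl (subst (0 <_) (count-suc f) 0<count)
    where
    by-cases : ∀ b → f zero ≡ b → 0 < 𝟙 b + count (f ∘ suc) → ∃ λ i → f i ≡ true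
    by-cases true  f₀ _         = zero , f₀
    by-cases false _  0<count′ = map suc (λ fi → fi) (count-pos (f ∘ suc) 0<count′)

  avoid-all : ∀ {m n} (A : Fin m → Bool) (B : Fin n → Fin m → Bool) →
              ∑[ j < n ] count (B j) < count A → ∃ λ i → A i ≡ true × ∀ j → B j i ≡ false
  avoid-all {n = zero} A B 0<count = map₂ (λ Ai → Ai , λ ()) (count-pos A 0<count)
  avoid-all {n = suc n} A B ∑B<A =
    let i , Ai∧¬B₀i , B′i = avoid-all (λ i → A i ∧ not (B zero i)) (B ∘ suc) ∑B′<A′
        Ai , ¬B₀i = ∧-≡-true Ai∧¬B₀i
    in i , Ai , λ { zero → not-≡-true ¬B₀i ; (suc j) → B′i j }
    where
    ∑B′<A′ : ∑[ j < n ] count (B (suc j)) < count (λ i → A i ∧ not (B zero i))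
    ∑B′<A′ = ℕ.+-cancelˡ-< (count (B zero)) _ _ (ℕ.<-≤-trans ∑B<A
      (subst (count A ≤_) (ℕ.+-comm _ (count (B zero))) (count≤count-∧-not+count A (B zero))))

open Counting

module CoreTriangles where
  open import Data.Bool.Properties using (∧-identityʳ; ∧-zeroʳ; ∨-conicalˡ; ∨-conicalʳ)
  open import Data.Nat.Base using (_+_; _≤_; _<_; _⊔_)
  open import Data.Fin.Base using (punchOut)
  open import Data.Fin.Patterns using (0F; 1F; 2F)
  open import Data.Fin.Properties using (_≟_; any?; pigeonhole; punchOut-injective)
  import Data.Fin.Properties as Fin
  import Data.Fin.Permutation as Permutation
  open import Data.Sum.Base using (_⊎_; inj₁; inj₂; [_,_]′)
  open import Data.Vec.Functional using (_++_)
  open import Data.Vec.Functional.Relation.Unary.All.Properties using (++⁺; ++⁻)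
  open import Data.Rational.Base as ℚ using (ℚ; 0ℚ; 1ℚ)
  import Data.Rational.Properties as ℚ
  open import Function.Base using (const)
  open import Function.Bundles using (_⇔_; mk⇔)
  open import Function.Definitions using (Injective)
  open import Relation.Nullary using (¬_; yes; no; contradiction)
  open import Relation.Nullary.Decidable using (⌊_⌋)
  open import Relation.Binary.Construct.Closure.ReflexiveTransitive as Star using (_◅_)

  injective⇒surjective : ∀ {n} (f : Fin n → Fin n) → Injective _≡_ _≡_ f → ∀ k → ∃ λ i → f i ≡ k
  injective⇒surjective {suc n} f f-inj k with any? (λ i → f i ≟ k)
  ... | yes hit = hit
  ... | no miss =
    let i , j , i<j , fi≡fj = pigeonhole (ℕ.n<1+n n) (λ i → punchOut (k≢f i))
    in contradiction (f-inj (punchOut-injective (k≢f i) (k≢f j) fi≡fj)) (Fin.<⇒≢ i<j)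
    where
    k≢f : ∀ i → k ≢ f i
    k≢f i k≡fi = miss (i , sym k≡fi)

  distinct-colours⇔≢ : ∀ {n} (col : Fin n → Fin 3) → Injective _≡_ _≡_ col →
                       ∀ {i j} → (not ⌊ col i ≟ col j ⌋ ≡ true) ⇔ (i ≢ j)
  distinct-colours⇔≢ col col-inj {i} {j} with col i ≟ col j
  ... | yes same = mk⇔ (λ ()) (λ i≢j → contradiction (col-inj same) i≢j)
  ... | no differ = mk⇔ (λ _ i≡j → differ (cong col i≡j)) (λ _ → refl)

  ∑-two-other-columns : ∀ (k : Fin 3) d → ∑[ k′ < 3 ] (if not ⌊ k ≟ k′ ⌋ then d else 0) ≡ d + d
  ∑-two-other-columns 0F d = cong (d +_) (ℕ.+-identityʳ d)
  ∑-two-other-columns 1F d = cong (d +_) (ℕ.+-identityʳ d)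
  ∑-two-other-columns 2F d = cong (d +_) (ℕ.+-identityʳ d)

  ∑-third-column : ∀ {k k′ : Fin 3} d → k ≢ k′ →
                   ∑[ k″ < 3 ] (if not ⌊ k ≟ k″ ⌋ ∧ not ⌊ k′ ≟ k″ ⌋ then d else 0) ≡ d
  ∑-third-column {0F} {0F} d k≢k′ = contradiction refl k≢k′
  ∑-third-column {0F} {1F} d _    = ℕ.+-identityʳ d
  ∑-third-column {0F} {2F} d _    = ℕ.+-identityʳ d
  ∑-third-column {1F} {0F} d _    = ℕ.+-identityʳ d
  ∑-third-column {1F} {1F} d k≢k′ = contradiction refl k≢k′
  ∑-third-column {1F} {2F} d _    = ℕ.+-identityʳ d
  ∑-third-column {2F} {0F} d _    = ℕ.+-identityʳ d
  ∑-third-column {2F} {1F} d _    = ℕ.+-identityʳ d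
  ∑-third-column {2F} {2F} d k≢k′ = contradiction refl k≢k′

  ⊔-+-≤ : ∀ a b c → a ⊔ (b ⊔ c) + a ≤ (a ⊔ b) + (a ⊔ c)
  ⊔-+-≤ a b c with ℕ.≤-total b c
  ... | inj₁ b≤c rewrite ℕ.m≤n⇒m⊔n≡n b≤c =
    subst (_≤ (a ⊔ b) + (a ⊔ c)) (ℕ.+-comm a (a ⊔ c)) (ℕ.+-monoˡ-≤ (a ⊔ c) (ℕ.m≤m⊔n a b))
  ... | inj₂ c≤b rewrite ℕ.m≥n⇒m⊔n≡m c≤b = ℕ.+-monoʳ-≤ (a ⊔ b) (ℕ.m≤m⊔n a c)

  module _ {m} (G : Graph m) where

    degP≡ : ∀ k g → degP G (k , g) ≡ deg G g + deg G g
    degP≡ k g = trans (sum-cong-≗ (λ k′ → count-∧ˡ (not ⌊ k ≟ k′ ⌋) (adj G g)))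
                      (∑-two-other-columns k (deg G g))

    commonP-column : ∀ {k k′} h → k ≢ k′ → countP (λ x → adjP G (k , h) x ∧ adjP G (k′ , h) x) ≡ deg G h
    commonP-column {k} {k′} h k≢k′ = trans
      (sum-cong-≗ (λ k″ → trans
        (count-cong (λ g → ∧-factorʳ (not ⌊ k ≟ k″ ⌋) (not ⌊ k′ ≟ k″ ⌋) (adj G h g)))
        (count-∧ˡ (not ⌊ k ≟ k″ ⌋ ∧ not ⌊ k′ ≟ k″ ⌋) (adj G h))))
      (∑-third-column (deg G h) k≢k′)
      where
      ∧-factorʳ : ∀ x y a → (x ∧ a) ∧ (y ∧ a) ≡ (x ∧ y) ∧ a
      ∧-factorʳ false y     a     = refl
      ∧-factorʳ true  false a     = ∧-zeroʳ a
      ∧-factorʳ true  true  true  = refl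
      ∧-factorʳ true  true  false = refl

  module _ {N m} {ε : ℚ} {G : Graph m} {H : Graph N} {ψ : Fin N ⤖ PV m} (near : Near ε G H ψ) where
    open Near near

    private
      to : Fin N → PV m
      to = Bijection.to ψ

      from : PV m → Fin N
      from y = proj₁ (Bijection.strictlySurjective ψ y)

      to-from : ∀ y → to (from y) ≡ y
      to-from y = proj₂ (Bijection.strictlySurjective ψ y)

    removedAt : PV m → ℕ
    removedAt y = countP (removed y)

    adj-from : ∀ y w → adj H (from y) w ≡ adjP G y (to w) ∧ not (removed y (to w))
    adj-from y w = trans (iso (from y) w) (cong (λ z → adjP G z (to w) ∧ not (removed z (to w))) (to-from y))

    deg-from+removedAt : ∀ y → deg H (from y) + removedAt y ≡ degP G y
    deg-from+removedAt y = begin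
      deg H (from y) + removedAt y
        ≡⟨ cong₂ _+_ (count-cong (adj-from y)) (sym (count-bijection ψ (removed y))) ⟩
      count (λ w → adjP G y (to w) ∧ not (removed y (to w))) + count (removed y ∘ to)
        ≡⟨ count-∧-not+count (adjP G y ∘ to) (removed y ∘ to) (λ w → removed-⊆ y (to w)) ⟩
      count (adjP G y ∘ to)
        ≡⟨ count-bijection ψ (adjP G y) ⟩
      degP G y ∎
      where open ≡-Reasoning

    common-from≤commonP : ∀ y z → common H (from y) (from z) ≤ countP (λ x → adjP G y x ∧ adjP G z x)
    common-from≤commonP y z = begin
      common H (from y) (from z)
        ≡⟨ count-cong (λ w → cong₂ _∧_ (adj-from y w) (adj-from z w)) ⟩
      count (λ w → (adjP G y (to w) ∧ not (removed y (to w))) ∧ (adjP G z (to w) ∧ not (removed z (to w))))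
        ≤⟨ count-∧-not-≤ (adjP G y ∘ to) (adjP G z ∘ to) (removed y ∘ to) (removed z ∘ to) ⟩
      count (λ w → adjP G y (to w) ∧ adjP G z (to w))
        ≡⟨ count-bijection ψ (λ x → adjP G y x ∧ adjP G z x) ⟩
      countP (λ x → adjP G y x ∧ adjP G z x) ∎
      where open ℕ.≤-Reasoning

    commonP≤common-from+removedAt : ∀ y z →
      countP (λ x → adjP G y x ∧ adjP G z x) ≤ common H (from y) (from z) + removedAt y + removedAt z
    commonP≤common-from+removedAt y z = begin
      countP (λ x → adjP G y x ∧ adjP G z x)
        ≡⟨ count-bijection ψ (λ x → adjP G y x ∧ adjP G z x) ⟨
      count (λ w → adjP G y (to w) ∧ adjP G z (to w))
        ≤⟨ count-∧-≤ (adjP G y ∘ to) (adjP G z ∘ to) (removed y ∘ to) (removed z ∘ to) ⟩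
      count (λ w → (adjP G y (to w) ∧ not (removed y (to w))) ∧ (adjP G z (to w) ∧ not (removed z (to w))))
        + count (removed y ∘ to) + count (removed z ∘ to)
        ≡⟨ cong₂ _+_ (cong₂ _+_ (count-cong (λ w → sym (cong₂ _∧_ (adj-from y w) (adj-from z w))))
                                (count-bijection ψ (removed y)))
                     (count-bijection ψ (removed z)) ⟩
      common H (from y) (from z) + removedAt y + removedAt z ∎
      where open ℕ.≤-Reasoning

    removedAt-bound : ∀ k g → ℕ→ℚ (removedAt (k , g)) ℚ.≤ ε ℚ.* (ℕ→ℚ (deg G g) ℚ.+ ℕ→ℚ (deg G g))
    removedAt-bound k g = ℚ.≤-trans (removed-few (k , g))
      (ℚ.≤-reflexive (cong (ε ℚ.*_) (trans (cong ℕ→ℚ (degP≡ G k g)) (ℕ→ℚ-+ (deg G g) (deg G g)))))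

    core-candCond : 0ℚ ℚ.≤ ε → ℕ→ℚ 6 ℚ.* ε ℚ.≤ 1ℚ → ∀ {k k′} h → k ≢ k′ →
                    candCond ε H (from (k , h)) (from (k′ , h))
    core-candCond 0≤ε 6ε≤1 {k} {k′} h k≢k′ =
      core-candidate-arithmetic _ _ 0≤ε 6ε≤1 (0≤ℕ→ℚ d) (0≤ℕ→ℚ (removedAt (k , h)))
        (removedAt-bound k h) (removedAt-bound k′ h) spanned bounded (degree k) (degree k′)
      where
      d c : ℕ
      d = deg G h
      c = common H (from (k , h)) (from (k′ , h))

      degree : ∀ k → ℕ→ℚ (deg H (from (k , h))) ≡ (ℕ→ℚ d ℚ.+ ℕ→ℚ d) ℚ.- ℕ→ℚ (removedAt (k , h))
      degree k = a+b≡c⇒a≡c-b (begin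
        ℕ→ℚ (deg H (from (k , h))) ℚ.+ ℕ→ℚ (removedAt (k , h)) ≡⟨ ℕ→ℚ-+ (deg H (from (k , h))) _ ⟨
        ℕ→ℚ (deg H (from (k , h)) + removedAt (k , h))         ≡⟨ cong ℕ→ℚ (trans (deg-from+removedAt (k , h)) (degP≡ G k h)) ⟩
        ℕ→ℚ (d + d)                                            ≡⟨ ℕ→ℚ-+ d d ⟩
        ℕ→ℚ d ℚ.+ ℕ→ℚ d                                        ∎)
        where open ≡-Reasoning

      spanned : ℕ→ℚ d ℚ.≤ ℕ→ℚ c ℚ.+ ℕ→ℚ (removedAt (k , h)) ℚ.+ ℕ→ℚ (removedAt (k′ , h))
      spanned = ℚ.≤-trans
        (ℕ→ℚ-mono-≤ (subst (_≤ c + removedAt (k , h) + removedAt (k′ , h)) (commonP-column G h k≢k′)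
                          (commonP≤common-from+removedAt (k , h) (k′ , h))))
        (ℚ.≤-reflexive (trans (ℕ→ℚ-+ (c + removedAt (k , h)) _) (cong (ℚ._+ _) (ℕ→ℚ-+ c _))))

      bounded : ℕ→ℚ c ℚ.≤ ℕ→ℚ d
      bounded = ℕ→ℚ-mono-≤ (subst (c ≤_) (commonP-column G h k≢k′) (common-from≤commonP (k , h) (k′ , h)))

    core-triangle : 0ℚ ℚ.≤ ε → ℕ→ℚ 6 ℚ.* ε ℚ.≤ 1ℚ →
                    (col : Fin 3 → Fin 3) → Injective _≡_ _≡_ col → Fin m → Triangle ε H
    core-triangle 0≤ε 6ε≤1 col col-inj h = record { pt = λ i → from (col i , h) ; cadj = candidate-edge }
      where
      candidate-edge : ∀ i j → i ≢ j → CandAdj ε H (from (col i , h)) (from (col j , h))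
      candidate-edge i j i≢j = distinct , oriented
        where
        u v : Fin N
        u = from (col i , h)
        v = from (col j , h)
        distinct : u ≢ v
        distinct eq = i≢j (col-inj (cong proj₁ (trans (sym (to-from _)) (trans (cong to eq) (to-from _)))))
        oriented : (deg H v ≤ deg H u × candCond ε H u v) ⊎ (deg H u ≤ deg H v × candCond ε H v u)
        oriented = [ (λ v≤u → inj₁ (v≤u , core-candCond 0≤ε 6ε≤1 h (i≢j ∘ col-inj)))
                   , (λ u≤v → inj₂ (u≤v , core-candCond 0≤ε 6ε≤1 h (i≢j ∘ sym ∘ col-inj)))
                   ]′ (ℕ.≤-total (deg H v) (deg H u))

    core-triangle-is-core : (0≤ε : 0ℚ ℚ.≤ ε) (6ε≤1 : ℕ→ℚ 6 ℚ.* ε ℚ.≤ 1ℚ) (col : Fin 3 → Fin 3)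
                            (col-inj : Injective _≡_ _≡_ col) (h : Fin m) →
                            IsCoreTriangleOf ψ h (core-triangle 0≤ε 6ε≤1 col col-inj h)
    core-triangle-is-core _ _ col col-inj h w = mk⇔ in-column in-triangle
      where
      in-column : ∃ (λ j → from (col j , h) ≡ w) → proj₂ (to w) ≡ h
      in-column (j , refl) = cong proj₂ (to-from (col j , h))
      in-triangle : proj₂ (to w) ≡ h → ∃ λ j → from (col j , h) ≡ w
      in-triangle refl with j , colj≡k ← injective⇒surjective col col-inj (proj₁ (to w)) =
        j , Bijection.injective ψ (trans (to-from _) (cong (_, proj₂ (to w)) colj≡k))

    compatible : (T₁ T₂ : Triangle ε H) (col : Fin 3 → Fin 3) → Injective _≡_ _≡_ col →
                 (g₁ g₂ : Fin 3 → Fin m) →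
                 (∀ i → to (pt T₁ i) ≡ (col i , g₁ i)) → (∀ j → to (pt T₂ j) ≡ (col j , g₂ j)) →
                 (∀ i j → adj G (g₁ i) (g₂ j) ≡ true) →
                 (∀ i j → removed (col i , g₁ i) (col j , g₂ j) ≡ false) →
                 Compatible T₁ T₂
    compatible T₁ T₂ col col-inj g₁ g₂ T₁-at T₂-at g₁~g₂ kept =
      disjoint , Permutation.id , Permutation.id , edge⇔≢
      where
      disjoint : ∀ w → w ∈T T₁ → ¬ (w ∈T T₂)
      disjoint w (i , refl) (j , T₂j≡w) = contradiction loop λ ()
        where
        open ≡-Reasoning
        g₂j≡g₁i : g₂ j ≡ g₁ i
        g₂j≡g₁i = cong proj₂ (trans (sym (T₂-at j)) (trans (cong to T₂j≡w) (T₁-at i)))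
        loop : false ≡ true
        loop = begin
          false               ≡⟨ irrefl G (g₁ i) ⟨
          adj G (g₁ i) (g₁ i) ≡⟨ cong (adj G (g₁ i)) g₂j≡g₁i ⟨
          adj G (g₁ i) (g₂ j) ≡⟨ g₁~g₂ i j ⟩
          true                ∎
      edge⇔≢ : ∀ i j → (adj H (pt T₁ i) (pt T₂ j) ≡ true) ⇔ (i ≢ j)
      edge⇔≢ i j = subst (λ b → (b ≡ true) ⇔ (i ≢ j)) (sym (edge-value i j)) (distinct-colours⇔≢ col col-inj)
        where
        edge-value : ∀ i j → adj H (pt T₁ i) (pt T₂ j) ≡ not ⌊ col i ≟ col j ⌋
        edge-value i j = begin
          adj H (pt T₁ i) (pt T₂ j)
            ≡⟨ iso (pt T₁ i) (pt T₂ j) ⟩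
          adjP G (to (pt T₁ i)) (to (pt T₂ j)) ∧ not (removed (to (pt T₁ i)) (to (pt T₂ j)))
            ≡⟨ cong₂ (λ x y → adjP G x y ∧ not (removed x y)) (T₁-at i) (T₂-at j) ⟩
          (not ⌊ col i ≟ col j ⌋ ∧ adj G (g₁ i) (g₂ j)) ∧ not (removed (col i , g₁ i) (col j , g₂ j))
            ≡⟨ cong₂ (λ a r → (not ⌊ col i ≟ col j ⌋ ∧ a) ∧ not r) (g₁~g₂ i j) (kept i j) ⟩
          (not ⌊ col i ≟ col j ⌋ ∧ true) ∧ true
            ≡⟨ trans (∧-identityʳ _) (∧-identityʳ _) ⟩
          not ⌊ col i ≟ col j ⌋ ∎
          where open ≡-Reasoning

    hits : PV m → Fin m → Bool
    hits w h = removed w (0F , h) ∨ (removed w (1F , h) ∨ removed w (2F , h))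

    count-hits≤removedAt : ∀ w → count (hits w) ≤ removedAt w
    count-hits≤removedAt w = begin
      count (hits w)                                     ≤⟨ count-∨-≤ (column 0F) _ ⟩
      count (column 0F) + count (λ h → column 1F h ∨ column 2F h)
        ≤⟨ ℕ.+-monoʳ-≤ (count (column 0F)) (count-∨-≤ (column 1F) (column 2F)) ⟩
      count (column 0F) + (count (column 1F) + count (column 2F))
        ≡⟨ cong (λ c → count (column 0F) + (count (column 1F) + c)) (ℕ.+-identityʳ _) ⟨
      removedAt w                                        ∎
      where
      open ℕ.≤-Reasoning
      column : Fin 3 → Fin m → Bool
      column k h = removed w (k , h)

    no-hits⇒kept : ∀ {w h} → hits w h ≡ false → ∀ k → removed w (k , h) ≡ false
    no-hits⇒kept {w} {h} no-hits 0F = ∨-conicalˡ (removed w (0F , h)) _ no-hits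
    no-hits⇒kept {w} {h} no-hits 1F =
      ∨-conicalˡ (removed w (1F , h)) _ (∨-conicalʳ (removed w (0F , h)) _ no-hits)
    no-hits⇒kept {w} {h} no-hits 2F =
      ∨-conicalʳ (removed w (1F , h)) _ (∨-conicalʳ (removed w (0F , h)) _ no-hits)

    clean-common-neighbour : 0ℚ ℚ.≤ ε → ℕ→ℚ 30 ℚ.* ε ℚ.≤ 1ℚ →
      (col : Fin 3 → Fin 3) (gv : Fin 3 → Fin m) (i₀ : Fin 3) →
      Confusable ε G (gv 0F) (gv 1F) → Confusable ε G (gv 0F) (gv 2F) →
      ∃ λ h → (∀ i → adj G (gv i) h ≡ true)
            × (∀ i k → removed (col i , gv i) (k , h) ≡ false)
            × (∀ i k → removed (col i , gv i₀) (k , h) ≡ false)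
    clean-common-neighbour 0≤ε 30ε≤1 col gv i₀ conf₀₁ conf₀₂ =
      let h , Ah , no-hits = avoid-all A (hits ∘ W) hits<neighbours
          no-hits-T , no-hits-g = ++⁻ (λ w → hits w h ≡ false) T-vertices no-hits
      in h , adjacent Ah , (no-hits⇒kept ∘ no-hits-T) , (no-hits⇒kept ∘ no-hits-g)
      where
      T-vertices g-vertices : Fin 3 → PV m
      T-vertices i = col i , gv i
      g-vertices i = col i , gv i₀
      W : Fin 6 → PV m
      W = T-vertices ++ g-vertices

      A : Fin m → Bool
      A h = adj G (gv 0F) h ∧ (adj G (gv 1F) h ∧ adj G (gv 2F) h)

      adjacent : ∀ {h} → A h ≡ true → ∀ i → adj G (gv i) h ≡ true
      adjacent {h} Ah 0F = proj₁ (∧-≡-true {adj G (gv 0F) h} Ah)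
      adjacent {h} Ah 1F = proj₁ (∧-≡-true {adj G (gv 1F) h} (proj₂ (∧-≡-true {adj G (gv 0F) h} Ah)))
      adjacent {h} Ah 2F = proj₂ (∧-≡-true {adj G (gv 1F) h} (proj₂ (∧-≡-true {adj G (gv 0F) h} Ah)))

      d : Fin 3 → ℕ
      d i = deg G (gv i)
      M : ℕ
      M = d 0F ⊔ (d 1F ⊔ d 2F)
      d≤M : ∀ i → d i ≤ M
      d≤M 0F = ℕ.m≤m⊔n (d 0F) _
      d≤M 1F = ℕ.≤-trans (ℕ.m≤m⊔n (d 1F) (d 2F)) (ℕ.m≤n⊔m (d 0F) _)
      d≤M 2F = ℕ.≤-trans (ℕ.m≤n⊔m (d 1F) (d 2F)) (ℕ.m≤n⊔m (d 0F) _)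

      removedAt≤ε[M+M] : ∀ k i → ℕ→ℚ (removedAt (k , gv i)) ℚ.≤ ε ℚ.* (ℕ→ℚ M ℚ.+ ℕ→ℚ M)
      removedAt≤ε[M+M] k i = ℚ.≤-trans (removedAt-bound k (gv i))
        (ℚ.*-monoˡ-≤-nonNeg ε {{ℚ.nonNegative 0≤ε}}
          (ℚ.+-mono-≤ (ℕ→ℚ-mono-≤ (d≤M i)) (ℕ→ℚ-mono-≤ (d≤M i))))

      removals<neighbours : ∑[ j < 6 ] removedAt (W j) < count A
      removals<neighbours = ℕ→ℚ-cancel-< (common-neighbours-outnumber-removals 0≤ε 30ε≤1 conf₀₁ conf₀₂
        (ℕ→ℚ-mono-≤-+ (common G (gv 0F) (gv 1F)) (common G (gv 0F) (gv 2F)) (count A) (d 0F)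
          (count-inclusion-exclusion (adj G (gv 0F)) (adj G (gv 1F)) (adj G (gv 2F))))
        (ℕ→ℚ-mono-≤-+ M (d 0F) (d 0F ⊔ d 1F) (d 0F ⊔ d 2F) (⊔-+-≤ (d 0F) (d 1F) (d 2F)))
        (0≤ℕ→ℚ (d 0F)) (ℕ→ℚ-mono-≤ (d≤M 0F))
        (ℕ→ℚ-∑-≤ 6 (removedAt ∘ W) (++⁺ (λ w → ℕ→ℚ (removedAt w) ℚ.≤ _)
          (λ i → removedAt≤ε[M+M] (col i) i) (λ i → removedAt≤ε[M+M] (col i) i₀))))

      hits<neighbours : ∑[ j < 6 ] count (hits (W j)) < count A
      hits<neighbours = ℕ.≤-<-trans (∑-mono-≤ (count-hits≤removedAt ∘ W)) removals<neighbours

    quasi-core⇒colours-injective : (T : Triangle ε H) → QuasiCore G ψ T → Injective _≡_ _≡_ (proj₁ ∘ to ∘ pt T)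
    quasi-core⇒colours-injective T quasi-core {i} {j} same-colour with i ≟ j
    ... | yes i≡j = i≡j
    ... | no i≢j  = contradiction same-colour (proj₁ (quasi-core i j i≢j))

    reaches-core-triangle : 0ℚ ℚ.≤ ε → ℕ→ℚ 30 ℚ.* ε ℚ.≤ 1ℚ →
      (T : Triangle ε H) → QuasiCore G ψ T → ∀ i₀ →
      Σ (Triangle ε H) λ T″ → IsCoreTriangleOf ψ (proj₂ (to (pt T i₀))) T″ × Reach T T″
    reaches-core-triangle 0≤ε 30ε≤1 T quasi-core i₀ =
      let h , h~gv , kept-T , kept-g =
            clean-common-neighbour 0≤ε 30ε≤1 col gv i₀ (confusable 0F 1F λ ()) (confusable 0F 2F λ ())
          T-h = core-triangle 0≤ε 6ε≤1 col col-inj h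
          T-g = core-triangle 0≤ε 6ε≤1 col col-inj g
          T⟶T-h = compatible T T-h col col-inj gv (const h) (λ _ → refl) (λ j → to-from (col j , h))
                    (λ i _ → h~gv i) (λ i j → kept-T i (col j))
          T-h⟶T-g = compatible T-h T-g col col-inj (const h) (const g)
                      (λ i → to-from (col i , h)) (λ j → to-from (col j , g))
                      (λ _ _ → trans (Graph.sym G h g) (h~gv i₀)) (λ i j → trans (removed-sym _ _) (kept-g j (col i)))
      in T-g , core-triangle-is-core 0≤ε 6ε≤1 col col-inj g , _◅_ {j = T-h} T⟶T-h (_◅_ {j = T-g} T-h⟶T-g Star.ε)
      where
      col : Fin 3 → Fin 3
      col i = proj₁ (to (pt T i))
      gv : Fin 3 → Fin m
      gv i = proj₂ (to (pt T i))
      g : Fin m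
      g = gv i₀
      col-inj : Injective _≡_ _≡_ col
      col-inj = quasi-core⇒colours-injective T quasi-core
      confusable : ∀ i j → i ≢ j → Confusable ε G (gv i) (gv j)
      confusable i j i≢j = proj₂ (quasi-core i j i≢j)
      6ε≤1 : ℕ→ℚ 6 ℚ.* ε ℚ.≤ 1ℚ
      6ε≤1 = ℚ.≤-trans (jε≤kε (ℕ.≤ᵇ⇒≤ 6 30 _) 0≤ε) 30ε≤1

open CoreTriangles

open import Data.Integer using (+_)
open import Data.Rational using (ℚ; _<_; _≤_; 0ℚ; _/_)
open import Data.Rational.Properties using (<⇒≤)
import Relation.Binary.Construct.Closure.ReflexiveTransitive as Star

lemma3p6 : (ε : ℚ) → 0ℚ ≤ ε → ε < + 1 / 40 →
    {N m : ℕ} (G : Graph m) (H : Graph N) (ψ : Fin N ⤖ PV m) →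
    Near ε G H ψ →
    (T : Triangle ε H) →
    -- the component Y of T in 𝒯(C) is a core component
    ((T' : Triangle ε H) → Reach T T' → QuasiCore G ψ T') →
    (u : Fin N) → u ∈T T →
    Σ (Triangle ε H) λ T'' →
      IsCoreTriangleOf ψ (proj₂ (Bijection.to ψ u)) T'' × Reach T T''
lemma3p6 ε 0≤ε ε<1/40 G H ψ near T core-component u (i₀ , refl) =
  reaches-core-triangle near 0≤ε (ε≤1/40⇒30ε≤1 (<⇒≤ ε<1/40)) T (core-component T Star.ε) i₀
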